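{- Let $x$ be an even positive integer. For every integer $s\ge1$, the multisets $\{1^{x+2s-2},x^{2sx-2s}\}$ and $\{1^{x+2s-1},x^{2sx-2s+2}\}$ each have a perfect linear realization.
   Context: For a positive integer $n$, $K_n$ is the complete graph on vertex set $\{0,\dots,n-1\}$ and the linear length of an edge $\{u,w\}$ is $|u-w|$. A multiset of size $n-1$ has a linear realization if some Hamiltonian path in $K_n$ has multiset of linear edge lengths equal to it; it is perfect if the path starts at $0$ and ends at $n-1$. $\{x_1^{a_1},\dots\}$ denotes the multiset with $x_i$ of multiplicity $a_i$. -}

module Defs where

open import Data.Nat using (ℕ; zero; suc; _+_; _∸_; _*_)
open import Data.List using (replicate; _++_)
open import Data.Nat.Base using (∣_-_∣)
open import Data.List using (List; []; _∷_; upTo; length)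
open import Data.List.Relation.Binary.Permutation.Propositional using (_↭_)
open import Data.Product using (_×_; Σ-syntax)
open import Relation.Binary.PropositionalEquality using (_≡_)

edgeLengths : List ℕ → List ℕ
edgeLengths []            = []
edgeLengths (u ∷ [])      = []
edgeLengths (u ∷ w ∷ ps)  = ∣ u - w ∣ ∷ edgeLengths (w ∷ ps)

-- A Hamiltonian path in K_n on vertex set {0,...,n-1}:
-- a listing of every vertex exactly once (a permutation of 0,...,n-1).
IsHamPath : ℕ → List ℕ → Set
IsHamPath n p = p ↭ upTo n

lastOr : ℕ → List ℕ → ℕ
lastOr d []       = d
lastOr d (y ∷ ys) = lastOr y ys

-- A multiset L (given as a list, up to permutation) of size n-1 has a
-- perfect linear realization: a Hamiltonian path in K_n from 0 to n-1
-- whose multiset of linear edge lengths is L.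
-- Here n = length L + 1.
PerfectRealization : List ℕ → Set
PerfectRealization L =
  Σ[ rest ∈ List ℕ ]
    IsHamPath (suc (length L)) (0 ∷ rest)
    × lastOr 0 rest ≡ length L
    × edgeLengths (0 ∷ rest) ↭ L

ms1x : ℕ → ℕ → ℕ → List ℕ
ms1x a x b = replicate a 1 ++ replicate b x

{-# OPTIONS --safe #-}
module Submission where

-- Arrange the vertices in columns of residues modulo x: a step inside a column has length x
-- and a step to the neighbouring column at the same height has length 1.  Write x = 2 + d with
-- d even, and t = 2s.  For the first multiset (n = (t + 1)x - 1) the path snakes up and down
-- the first d columns, all of height t + 1, and then climbs a ladder zigzagging between the last
-- two columns (heights t + 1 and t) with alternating steps 1 and x.  For the second multiset
-- (n = (t + 1)x + 2, so columns 0 and 1 are one vertex taller) the path runs down column 1,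
-- snakes through columns 2, …, x - 3, climbs the ladder on the last two columns, steps over to
-- the top of column 0 and runs down it; its reverse is the required path.  For x = 2 the
-- second path is 0, 2, 1 followed by a ladder.

open import Defs
open import Data.Nat using (ℕ; zero; suc; _+_; _∸_; _*_; _<_; _≤_; ∣_-_∣)
open import Data.Nat.Divisibility using (_∣_; divides)
open import Data.Nat.Properties
  using (+-assoc; +-comm; +-suc; +-identityʳ; *-suc; *-comm; *-identityʳ; ∣-∣-comm; ∣m-m+n∣≡n; m+n∸m≡n)
open import Data.Nat.Tactic.RingSolver using (solve-∀)
open import Data.List using (List; []; _∷_; _++_; [_]; _∷ʳ_; replicate; upTo; length; reverse)
open import Data.List.Properties using (++-assoc; ++-identityʳ; unfold-reverse; length-++; length-replicate; upTo-∷ʳ)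
open import Data.List.Relation.Binary.Permutation.Propositional
  using (_↭_; ↭-refl; ↭-sym; ↭-trans; ↭-prep; ↭-swap; ↭-reflexive; module PermutationReasoning)
open import Data.List.Relation.Binary.Permutation.Propositional.Properties
  using (++⁺ˡ; ++⁺ʳ; ++⁺; shift; shifts; ∷↭∷ʳ; ↭-reverse; ++-comm)
open import Data.Product using (_×_; _,_; ∃-syntax)
open import Relation.Binary.PropositionalEquality
  using (_≡_; refl; sym; trans; cong; cong₂; subst; subst₂; module ≡-Reasoning)

double : ℕ → ℕ
double zero    = zero
double (suc n) = suc (suc (double n))

double≡2* : ∀ n → double n ≡ 2 * n
double≡2* zero    = refl
double≡2* (suc n) = cong suc (trans (cong suc (double≡2* n)) (sym (+-suc n (n + 0))))

m*[1+n]∸m≡m*n : ∀ m n → m * suc n ∸ m ≡ m * n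
m*[1+n]∸m≡m*n m n = trans (cong (_∸ m) (*-suc m n)) (m+n∸m≡n m (m * n))

∣n-1+n∣≡1 : ∀ n → ∣ n - suc n ∣ ≡ 1
∣n-1+n∣≡1 zero    = refl
∣n-1+n∣≡1 (suc n) = ∣n-1+n∣≡1 n

lastOr-++ : ∀ d xs y ys → lastOr d (xs ++ y ∷ ys) ≡ lastOr y ys
lastOr-++ d []       y ys = refl
lastOr-++ d (u ∷ xs) y ys = lastOr-++ u xs y ys

edgeLengths-++ : ∀ h t h′ t′ →
  edgeLengths (h ∷ t ++ h′ ∷ t′) ≡ edgeLengths (h ∷ t) ++ ∣ lastOr h t - h′ ∣ ∷ edgeLengths (h′ ∷ t′)
edgeLengths-++ h []      h′ t′ = refl
edgeLengths-++ h (u ∷ t) h′ t′ = cong (∣ h - u ∣ ∷_) (edgeLengths-++ u t h′ t′)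

reverse-∷ : ∀ h t → ∃[ t′ ] reverse (h ∷ t) ≡ lastOr h t ∷ t′ × lastOr (lastOr h t) t′ ≡ h
reverse-∷ h []      = [] , refl , refl
reverse-∷ h (u ∷ t) with reverse-∷ u t
... | t′ , rev≡ , _ = t′ ∷ʳ h , trans (unfold-reverse h (u ∷ t)) (cong (_∷ʳ h) rev≡) , lastOr-++ _ t′ h []

edgeLengths-reverse : ∀ l → edgeLengths (reverse l) ≡ reverse (edgeLengths l)
edgeLengths-reverse []          = refl
edgeLengths-reverse (h ∷ [])    = refl
edgeLengths-reverse (h ∷ u ∷ t) with reverse-∷ u t | edgeLengths-reverse (u ∷ t)
... | t′ , rev≡ , last≡ | ih = begin
  edgeLengths (reverse (h ∷ u ∷ t))
    ≡⟨ cong edgeLengths (trans (unfold-reverse h (u ∷ t)) (cong (_∷ʳ h) rev≡)) ⟩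
  edgeLengths (lastOr u t ∷ t′ ++ [ h ])
    ≡⟨ edgeLengths-++ (lastOr u t) t′ h [] ⟩
  edgeLengths (lastOr u t ∷ t′) ++ [ ∣ lastOr (lastOr u t) t′ - h ∣ ]
    ≡⟨ cong₂ (λ r δ → r ++ [ δ ]) (trans (cong edgeLengths (sym rev≡)) ih)
                                  (trans (cong ∣_- h ∣ last≡) (∣-∣-comm u h)) ⟩
  reverse (edgeLengths (u ∷ t)) ∷ʳ ∣ h - u ∣
    ≡⟨ unfold-reverse ∣ h - u ∣ (edgeLengths (u ∷ t)) ⟨
  reverse (edgeLengths (h ∷ u ∷ t)) ∎
  where open ≡-Reasoning

length-ms1x : ∀ a x b → length (ms1x a x b) ≡ a + b
length-ms1x a x b = trans (length-++ (replicate a 1)) (cong₂ _+_ (length-replicate a) (length-replicate b))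

x∷ms1x : ∀ {x} a b → x ∷ ms1x a x b ↭ ms1x a x (suc b)
x∷ms1x {x} a b = ↭-sym (shift x (replicate a 1) (replicate b x))

ms1x-++ : ∀ x a b c d → ms1x a x b ++ ms1x c x d ↭ ms1x (a + c) x (b + d)
ms1x-++ x (suc a) b       c d = ↭-prep 1 (ms1x-++ x a b c d)
ms1x-++ x zero    zero    c d = ↭-refl
ms1x-++ x zero    (suc b) c d = ↭-trans (↭-prep x (ms1x-++ x zero b c d)) (x∷ms1x c (b + d))

module Paths (x : ℕ) where

  record Segment (l : List ℕ) (h e a b : ℕ) : Set where
    constructor segment
    field
      rest     : List ℕ
      l≡h∷rest : l ≡ h ∷ rest
      last≡e   : lastOr h rest ≡ e
      lengths  : edgeLengths l ↭ ms1x a x b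

  private
    variable
      l l₁ l₂ : List ℕ
      h h₁ h₂ e e′ e₁ e₂ a a′ a₁ a₂ b b′ b₁ b₂ : ℕ

  point : ∀ v → Segment [ v ] v v 0 0
  point v = segment [] refl refl ↭-refl

  reindex : e ≡ e′ → a ≡ a′ → b ≡ b′ → Segment l h e a b → Segment l h e′ a′ b′
  reindex refl refl refl s = s

  join : ∀ {δ} → Segment l₁ h₁ e₁ a₁ b₁ → Segment l₂ h₂ e₂ a₂ b₂ →
         ∣ e₁ - h₂ ∣ ≡ δ → δ ∷ ms1x a₂ x b₂ ↭ ms1x a′ x b′ →
         Segment (l₁ ++ l₂) h₁ e₂ (a₁ + a′) (b₁ + b′)
  join {h₁ = h₁} {a₁ = a₁} {b₁ = b₁} {h₂ = h₂} {a′ = a′} {b′ = b′}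
       (segment t₁ refl refl p₁) (segment t₂ refl refl p₂) refl q =
    segment (t₁ ++ h₂ ∷ t₂) refl (lastOr-++ h₁ t₁ h₂ t₂) (begin
      edgeLengths (h₁ ∷ t₁ ++ h₂ ∷ t₂)
        ≡⟨ edgeLengths-++ h₁ t₁ h₂ t₂ ⟩
      edgeLengths (h₁ ∷ t₁) ++ _ ∷ edgeLengths (h₂ ∷ t₂)
        ↭⟨ ++⁺ p₁ (↭-trans (↭-prep _ p₂) q) ⟩
      ms1x a₁ x b₁ ++ ms1x a′ x b′
        ↭⟨ ms1x-++ x a₁ b₁ a′ b′ ⟩
      ms1x (a₁ + a′) x (b₁ + b′) ∎)
    where open PermutationReasoning

  join₁ : Segment l₁ h₁ e₁ a₁ b₁ → Segment l₂ h₂ e₂ a₂ b₂ → ∣ e₁ - h₂ ∣ ≡ 1 →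
          Segment (l₁ ++ l₂) h₁ e₂ (a₁ + suc a₂) (b₁ + b₂)
  join₁ s₁ s₂ step = join s₁ s₂ step ↭-refl

  joinₓ : Segment l₁ h₁ e₁ a₁ b₁ → Segment l₂ h₂ e₂ a₂ b₂ → ∣ e₁ - h₂ ∣ ≡ x →
          Segment (l₁ ++ l₂) h₁ e₂ (a₁ + a₂) (b₁ + suc b₂)
  joinₓ {a₂ = a₂} {b₂ = b₂} s₁ s₂ step = join s₁ s₂ step (x∷ms1x a₂ b₂)

  segment-reverse : Segment l h e a b → Segment (reverse l) e h a b
  segment-reverse {h = h} (segment t refl refl p) with reverse-∷ h t
  ... | t′ , rev≡ , last≡ =
    segment t′ rev≡ last≡ (↭-trans (↭-reflexive (edgeLengths-reverse (h ∷ t))) (↭-trans (↭-reverse _) p))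

  up : ℕ → ℕ → List ℕ
  up v zero    = []
  up v (suc h) = v ∷ up (v + x) h

  down : ℕ → ℕ → List ℕ
  down v h = reverse (up v h)

  columns : ℕ → ℕ → ℕ → List ℕ
  columns v zero    h = []
  columns v (suc k) h = up v h ++ columns (suc v) k h

  snake : ℕ → ℕ → ℕ → List ℕ
  snake v zero    h = []
  snake v (suc k) h = up v h ++ down (suc v) h ++ snake (suc (suc v)) k h

  rung : ℕ → List ℕ
  rung v = v ∷ suc v ∷ suc v + x ∷ v + x ∷ []

  ladder : ℕ → ℕ → List ℕ
  ladder v zero    = [ v ]
  ladder v (suc k) = rung v ++ ladder (v + x + x) k

  segment-up : ∀ v h → Segment (up v (suc h)) v (v + h * x) 0 h
  segment-up v zero    = reindex (sym (+-identityʳ v)) refl refl (point v)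
  segment-up v (suc h) =
    reindex (+-assoc v x (h * x)) refl refl (joinₓ (point v) (segment-up (v + x) h) (∣m-m+n∣≡n v x))

  segment-down : ∀ v h → Segment (down v (suc h)) (v + h * x) v 0 h
  segment-down v h = segment-reverse (segment-up v h)

  segment-snake++ : ∀ k v h {S w e a b} → Segment S w e a b → w ≡ v + double k →
                    Segment (snake v k (suc h) ++ S) v e (double k + a) (double k * h + b)
  segment-snake++ zero    v h s w≡v = subst (λ w → Segment _ w _ _ _) (trans w≡v (+-identityʳ v)) s
  segment-snake++ (suc k) v h {S} {e = e} {a} {b} s w≡ =
    subst (λ l → Segment l v e (double (suc k) + a) (double (suc k) * h + b)) list≡ (reindex refl refl count≡
      (join₁ (segment-up v h) (join₁ (segment-down (suc v) h) rest (∣n-1+n∣≡1 (suc v))) (∣n-1+n∣≡1 (v + h * x))))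
    where
    D : ℕ
    D = double k * h
    rest : Segment (snake (suc (suc v)) k (suc h) ++ S) (suc (suc v)) e (double k + a) (D + b)
    rest = segment-snake++ k (suc (suc v)) h s (trans w≡ (trans (+-suc v _) (cong suc (+-suc v _))))
    count≡ : h + (h + (D + b)) ≡ (h + (h + D)) + b
    count≡ = sym (trans (+-assoc h (h + D) b) (cong (h +_) (+-assoc h D b)))
    list≡ : up v (suc h) ++ down (suc v) (suc h) ++ snake (suc (suc v)) k (suc h) ++ S
          ≡ snake v (suc k) (suc h) ++ S
    list≡ = sym (trans (++-assoc (up v (suc h)) _ S) (cong (up v (suc h) ++_) (++-assoc (down (suc v) (suc h)) _ S)))

  segment-rung : ∀ v → Segment (rung v) v (v + x) 2 1
  segment-rung v = segment _ refl refl (↭-trans (↭-reflexive lengths≡) (↭-prep 1 (↭-swap x 1 ↭-refl)))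
    where
    lengths≡ : edgeLengths (rung v) ≡ 1 ∷ x ∷ 1 ∷ []
    lengths≡ = cong₂ _∷_ (∣n-1+n∣≡1 v) (cong₂ _∷_ (∣m-m+n∣≡n (suc v) x)
                 (cong [_] (trans (∣-∣-comm (suc (v + x)) (v + x)) (∣n-1+n∣≡1 (v + x)))))

  segment-ladder : ∀ v k → Segment (ladder v k) v (v + double k * x) (double k) (double k)
  segment-ladder v zero    = reindex (sym (+-identityʳ v)) refl refl (point v)
  segment-ladder v (suc k) =
    reindex (trans (+-assoc (v + x) x _) (+-assoc v x _)) refl refl
      (joinₓ (segment-rung v) (segment-ladder (v + x + x) k) (∣m-m+n∣≡n (v + x) x))

  up-∷ʳ : ∀ v h → up v h ∷ʳ (v + h * x) ≡ up v (suc h)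
  up-∷ʳ v zero    = cong [_] (+-identityʳ v)
  up-∷ʳ v (suc h) = cong (v ∷_) (trans (cong (up (v + x) h ∷ʳ_) (sym (+-assoc v x (h * x)))) (up-∷ʳ (v + x) h))

  columns-++-up : ∀ v k h → columns v k h ++ up (v + k) h ≡ columns v (suc k) h
  columns-++-up v zero    h = trans (cong (λ w → up w h) (+-identityʳ v)) (sym (++-identityʳ (up v h)))
  columns-++-up v (suc k) h = begin
    (up v h ++ columns (suc v) k h) ++ up (v + suc k) h ≡⟨ ++-assoc (up v h) _ _ ⟩
    up v h ++ columns (suc v) k h ++ up (v + suc k) h   ≡⟨ cong (λ w → up v h ++ columns (suc v) k h ++ up w h) (+-suc v k) ⟩
    up v h ++ columns (suc v) k h ++ up (suc v + k) h   ≡⟨ cong (up v h ++_) (columns-++-up (suc v) k h) ⟩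
    up v h ++ columns (suc v) (suc k) h                  ∎
    where open ≡-Reasoning

  columns-height0 : ∀ v k → columns v k 0 ≡ []
  columns-height0 v zero    = refl
  columns-height0 v (suc k) = columns-height0 (suc v) k

  snake↭columns : ∀ v k h → snake v k h ↭ columns v (double k) h
  snake↭columns v zero    h = ↭-refl
  snake↭columns v (suc k) h = ++⁺ˡ (up v h) (++⁺ (↭-reverse (up (suc v) h)) (snake↭columns (suc (suc v)) k h))

  ladder↭columns : ∀ v k → ladder v k ↭ up v (suc (double k)) ++ up (suc v) (double k)
  ladder↭columns v zero    = ↭-refl
  ladder↭columns v (suc k) =
    ↭-trans (↭-prep v (↭-prep (suc v) (↭-prep (suc v + x) (↭-prep (v + x) (ladder↭columns (v + x + x) k)))))
      (↭-prep v (↭-trans (shift (v + x) (suc v ∷ suc v + x ∷ []) _)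
        (↭-prep (v + x) (shifts (suc v ∷ suc v + x ∷ []) (up (v + x + x) (suc (double k)))))))

  ladder-∷ʳ↭columns : ∀ v k → ladder v k ∷ʳ (suc v + double k * x) ↭ up v (suc (double k)) ++ up (suc v) (suc (double k))
  ladder-∷ʳ↭columns v k = begin
    ladder v k ∷ʳ top                   ↭⟨ ++⁺ʳ _ (ladder↭columns v k) ⟩
    (P ++ up (suc v) (double k)) ∷ʳ top ≡⟨ ++-assoc P _ _ ⟩
    P ++ up (suc v) (double k) ∷ʳ top   ≡⟨ cong (P ++_) (up-∷ʳ (suc v) (double k)) ⟩
    P ++ up (suc v) (suc (double k))    ∎
    where
    open PermutationReasoning
    P : List ℕ
    P = up v (suc (double k))
    top : ℕ
    top = suc v + double k * x

  columns-∷ʳ : ∀ R r c →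
    (columns 0 r (suc R) ++ columns r (suc c) R) ∷ʳ (r + R * x) ↭ columns 0 (suc r) (suc R) ++ columns (suc r) c R
  columns-∷ʳ R r c = begin
    (A ++ up r R ++ B) ∷ʳ p   ≡⟨ trans (++-assoc A _ _) (cong (A ++_) (++-assoc (up r R) B _)) ⟩
    A ++ up r R ++ B ∷ʳ p     ↭⟨ ++⁺ˡ A (++⁺ˡ (up r R) (↭-sym (∷↭∷ʳ p B))) ⟩
    A ++ up r R ++ p ∷ B      ≡⟨ trans (cong (A ++_) (sym (++-assoc (up r R) [ p ] B))) (sym (++-assoc A _ B)) ⟩
    (A ++ up r R ∷ʳ p) ++ B   ≡⟨ cong (λ u → (A ++ u) ++ B) (up-∷ʳ r R) ⟩
    (A ++ up r (suc R)) ++ B  ≡⟨ cong (_++ B) (columns-++-up 0 r (suc R)) ⟩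
    columns 0 (suc r) (suc R) ++ B ∎
    where
    open PermutationReasoning
    A = columns 0 r (suc R)
    B = columns (suc r) c R
    p = r + R * x

  upTo↭columns : ∀ R r c → r + c ≡ x → upTo (r + R * x) ↭ columns 0 r (suc R) ++ columns r c R
  upTo↭columns zero    zero    c _    = ↭-reflexive (sym (columns-height0 0 c))
  upTo↭columns (suc R) zero    c refl = ↭-trans (upTo↭columns R c 0 (+-identityʳ c)) (↭-reflexive (++-identityʳ _))
  upTo↭columns R       (suc r) c r+c≡x = begin
    upTo (suc r + R * x)                                        ≡⟨ upTo-∷ʳ (r + R * x) ⟨
    upTo (r + R * x) ∷ʳ (r + R * x)                             ↭⟨ ++⁺ʳ _ (upTo↭columns R r (suc c) (trans (+-suc r c) r+c≡x)) ⟩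
    (columns 0 r (suc R) ++ columns r (suc c) R) ∷ʳ (r + R * x) ↭⟨ columns-∷ʳ R r c ⟩
    columns 0 (suc r) (suc R) ++ columns (suc r) c R            ∎
    where open PermutationReasoning

  perfectRealization : Segment l 0 (a + b) a b → l ↭ upTo (suc (a + b)) → PerfectRealization (ms1x a x b)
  perfectRealization {a = a} {b = b} (segment rest refl last≡ lengths) vertices rewrite length-ms1x a x b =
    rest , vertices , last≡ , lengths

realization₁ : ∀ m s →
  PerfectRealization (ms1x (double m + double s) (2 + double m) (double s * suc (double m)))
realization₁ m s = perfectRealization (reindex (end≡ d t) refl (count≡ d t) path) vertices
  where
  open Paths (2 + double m)
  d t : ℕ
  d = double m
  t = double s
  path : Segment (snake 0 m (suc t) ++ ladder d s) 0 (d + t * (2 + d)) (d + t) (d * t + t)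
  path = segment-snake++ m 0 t (segment-ladder d s) refl
  end≡ : ∀ d t → d + t * (2 + d) ≡ (d + t) + t * suc d
  end≡ = solve-∀
  count≡ : ∀ d t → d * t + t ≡ t * suc d
  count≡ = solve-∀
  size≡ : ∀ d t → suc d + t * (2 + d) ≡ suc ((d + t) + t * suc d)
  size≡ = solve-∀
  vertices : snake 0 m (suc t) ++ ladder d s ↭ upTo (suc ((d + t) + t * suc d))
  vertices = begin
    snake 0 m (suc t) ++ ladder d s                       ↭⟨ ++⁺ (snake↭columns 0 m (suc t)) (ladder↭columns d s) ⟩
    columns 0 d (suc t) ++ up d (suc t) ++ up (suc d) t   ≡⟨ sym (++-assoc (columns 0 d (suc t)) _ _) ⟩
    (columns 0 d (suc t) ++ up d (suc t)) ++ up (suc d) t ≡⟨ cong₂ _++_ (columns-++-up 0 d (suc t)) (sym (++-identityʳ _)) ⟩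
    columns 0 (suc d) (suc t) ++ columns (suc d) 1 t      ↭⟨ upTo↭columns t (suc d) 1 (+-comm (suc d) 1) ⟨
    upTo (suc d + t * (2 + d))                            ≡⟨ cong upTo (size≡ d t) ⟩
    upTo (suc ((d + t) + t * suc d))                      ∎
    where open PermutationReasoning

realization₂ : ∀ m s →
  PerfectRealization (ms1x (3 + double m + double s) (4 + double m) (double s * (3 + double m) + 2))
realization₂ m s = perfectRealization (reindex (end≡ d t) (count₁≡ d t) (countₓ≡ d t) (segment-reverse path)) vertices
  where
  open Paths (4 + double m)
  d t top : ℕ
  d = double m
  t = double s
  top = 3 + d + t * (4 + d)
  walk : List ℕ
  walk = down 1 (2 + t) ++ snake 2 m (suc t) ++ ladder (2 + d) s ++ top ∷ down 0 (2 + t)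
  path : Segment walk (1 + suc t * (4 + d)) 0 (suc (d + (t + 2))) (suc t + (d * t + (t + suc t)))
  path = join₁ (segment-down 1 (suc t))
           (segment-snake++ m 2 t
             (join₁ (segment-ladder (2 + d) s)
                    (join₁ (point top) (segment-down 0 (suc t)) (∣n-1+n∣≡1 top))
                    (∣n-1+n∣≡1 (2 + d + t * (4 + d))))
             refl)
           refl
  end≡ : ∀ d t → 1 + suc t * (4 + d) ≡ (3 + d + t) + (t * (3 + d) + 2)
  end≡ = solve-∀
  count₁≡ : ∀ d t → suc (d + (t + 2)) ≡ 3 + d + t
  count₁≡ = solve-∀
  countₓ≡ : ∀ d t → suc t + (d * t + (t + suc t)) ≡ t * (3 + d) + 2
  countₓ≡ = solve-∀
  size≡ : ∀ d t → 2 + suc t * (4 + d) ≡ suc ((3 + d + t) + (t * (3 + d) + 2))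
  size≡ = solve-∀
  U₀ U₁ C P Q : List ℕ
  U₀ = up 0 (2 + t)
  U₁ = up 1 (2 + t)
  C = columns 2 d (suc t)
  P = up (2 + d) (suc t)
  Q = up (3 + d) (suc t)
  columns≡ : C ++ P ++ Q ≡ columns 2 (2 + d) (suc t)
  columns≡ = begin
    C ++ P ++ Q                    ≡⟨ sym (++-assoc C P Q) ⟩
    (C ++ P) ++ Q                  ≡⟨ cong (_++ Q) (columns-++-up 2 d (suc t)) ⟩
    columns 2 (suc d) (suc t) ++ Q ≡⟨ columns-++-up 2 (suc d) (suc t) ⟩
    columns 2 (2 + d) (suc t)      ∎
    where open ≡-Reasoning
  vertices : reverse walk ↭ upTo (suc ((3 + d + t) + (t * (3 + d) + 2)))
  vertices = begin
    reverse walk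
      ↭⟨ ↭-reverse walk ⟩
    down 1 (2 + t) ++ snake 2 m (suc t) ++ ladder (2 + d) s ++ top ∷ down 0 (2 + t)
      ≡⟨ cong (λ l → down 1 (2 + t) ++ snake 2 m (suc t) ++ l) (sym (++-assoc (ladder (2 + d) s) [ top ] _)) ⟩
    down 1 (2 + t) ++ snake 2 m (suc t) ++ (ladder (2 + d) s ∷ʳ top) ++ down 0 (2 + t)
      ↭⟨ ++⁺ (↭-reverse U₁) (++⁺ (snake↭columns 2 m (suc t)) (++⁺ (ladder-∷ʳ↭columns (2 + d) s) (↭-reverse U₀))) ⟩
    U₁ ++ C ++ (P ++ Q) ++ U₀
      ≡⟨ trans (cong (U₁ ++_) (sym (++-assoc C _ U₀))) (sym (++-assoc U₁ _ U₀)) ⟩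
    (U₁ ++ C ++ P ++ Q) ++ U₀
      ↭⟨ ++-comm (U₁ ++ C ++ P ++ Q) U₀ ⟩
    U₀ ++ U₁ ++ C ++ P ++ Q
      ≡⟨ trans (cong₂ (λ u w → U₀ ++ u ++ w) (sym (++-identityʳ U₁)) columns≡) (sym (++-assoc U₀ _ _)) ⟩
    columns 0 2 (2 + t) ++ columns 2 (2 + d) (suc t)
      ↭⟨ upTo↭columns (suc t) 2 (2 + d) refl ⟨
    upTo (2 + suc t * (4 + d))
      ≡⟨ cong upTo (size≡ d t) ⟩
    upTo (suc ((3 + d + t) + (t * (3 + d) + 2))) ∎
    where open PermutationReasoning

realization₂-two : ∀ s → PerfectRealization (ms1x (suc (double s)) 2 (double s + 2))
realization₂-two s = perfectRealization (reindex (end≡ t) refl (+-comm 2 t) path) vertices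
  where
  open Paths 2
  t : ℕ
  t = double s
  path : Segment (0 ∷ 2 ∷ 1 ∷ ladder 3 s) 0 (3 + t * 2) (suc t) (2 + t)
  path = joinₓ (segment (2 ∷ 1 ∷ []) refl refl (↭-swap 2 1 ↭-refl)) (segment-ladder 3 s) refl
  end≡ : ∀ t → 3 + t * 2 ≡ suc t + (t + 2)
  end≡ = solve-∀
  size≡ : ∀ t → (2 + t) * 2 ≡ suc (suc t + (t + 2))
  size≡ = solve-∀
  vertices : 0 ∷ 2 ∷ 1 ∷ ladder 3 s ↭ upTo (suc (suc t + (t + 2)))
  vertices = begin
    0 ∷ 2 ∷ 1 ∷ ladder 3 s                   ↭⟨ ↭-prep 0 (↭-prep 2 (↭-prep 1 (ladder↭columns 3 s))) ⟩
    0 ∷ 2 ∷ (1 ∷ up 3 (suc t)) ++ up 4 t      ↭⟨ ↭-prep 0 (↭-prep 2 (++-comm (1 ∷ up 3 (suc t)) (up 4 t))) ⟩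
    0 ∷ 2 ∷ up 4 t ++ 1 ∷ up 3 (suc t)        ≡⟨ cong (λ u → 0 ∷ 2 ∷ up 4 t ++ u) (sym (++-identityʳ _)) ⟩
    columns 0 2 (2 + t)                       ↭⟨ upTo↭columns (2 + t) 0 2 refl ⟨
    upTo ((2 + t) * 2)                        ≡⟨ cong upTo (size≡ t) ⟩
    upTo (suc (suc t + (t + 2)))              ∎
    where open PermutationReasoning

Realizations : ℕ → ℕ → Set
Realizations x t = PerfectRealization (ms1x (x + t ∸ 2) x (t * x ∸ t))
                 × PerfectRealization (ms1x (x + t ∸ 1) x (t * x ∸ t + 2))

realizations : ∀ m s → Realizations (2 + double m) (double s)
realizations m s = first , second m
  where
  t : ℕ
  t = double s
  first : PerfectRealization (ms1x (double m + t) (2 + double m) (t * (2 + double m) ∸ t))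
  first = subst (λ b → PerfectRealization (ms1x (double m + t) (2 + double m) b))
                (sym (m*[1+n]∸m≡m*n t (suc (double m)))) (realization₁ m s)
  second : ∀ n → PerfectRealization (ms1x (2 + double n + t ∸ 1) (2 + double n) (t * (2 + double n) ∸ t + 2))
  second zero    = subst (λ b → PerfectRealization (ms1x (suc t) 2 (b + 2)))
                     (sym (trans (m*[1+n]∸m≡m*n t 1) (*-identityʳ t))) (realization₂-two s)
  second (suc n) = subst (λ b → PerfectRealization (ms1x (3 + double n + t) (4 + double n) (b + 2)))
                     (sym (m*[1+n]∸m≡m*n t (3 + double n))) (realization₂ n s)

lemma4p4 : (x : ℕ) → 0 < x → 2 ∣ x → (s : ℕ) → 1 ≤ s →
    PerfectRealization (ms1x (x + 2 * s ∸ 2) x (2 * s * x ∸ 2 * s))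
    × PerfectRealization (ms1x (x + 2 * s ∸ 1) x (2 * s * x ∸ 2 * s + 2))
lemma4p4 _ () (divides zero refl) _ _
lemma4p4 x _ (divides (suc m) x≡[1+m]*2) s _ =
  subst₂ Realizations (sym x≡2+double[m]) (double≡2* s) (realizations m s)
  where
  x≡2+double[m] : x ≡ 2 + double m
  x≡2+double[m] = trans x≡[1+m]*2 (cong (2 +_) (trans (*-comm m 2) (sym (double≡2* m))))
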